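{- Let $D_1,D_2$ be coprime positive odd integers with $\min(D_1,D_2)>1$, and let $D=D_1D_2$. Suppose the equation $$D_1X^2 + D_2Y^2 = 2^{Z+2},\quad X,Y,Z\in\mathbb{Z},\ \gcd(X,Y)=1,\ Z>0$$ has a solution $(X,Y,Z)$. Then the equation $$X'^2 + DY'^2 = 2^{Z'+2},\quad X',Y',Z'\in\mathbb{Z},\ \gcd(X',Y')=1,\ Z'>0$$ has no solution $(X',Y',Z')$ with $Z'=Z$. -}

module Defs where

open import Data.Nat using (ℕ; _<_)
open import Data.Nat.Divisibility using (_∣_)
open import Data.Integer using (ℤ; +_; _+_; _*_; _^_)
open import Data.Integer.GCD using (gcd)
open import Data.Product using (_×_)
open import Relation.Binary.PropositionalEquality using (_≡_)
open import Relation.Nullary using (¬_)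

Odd : ℕ → Set
Odd n = ¬ (2 ∣ n)

IsSolution : ℕ → ℕ → ℤ → ℤ → ℕ → Set
IsSolution A B X Y Z =
  ((+ A) * X ^ 2 + (+ B) * Y ^ 2 ≡ + (2 Data.Nat.^ (Z Data.Nat.+ 2)))
  × (gcd X Y ≡ + 1) × (0 < Z)

module Submission where

-- Brahmagupta's composition of the two forms gives, for A± = X X′ ± D₂ Y Y′ and N = 2^(Z+2),
--   D₁ A±² + D₂ (D₁ X Y′ ∓ Y X′)² = N²   and   D₁ A₊ A₋ = N (N − D₁ D₂ Y′² − D₂ Y²),
-- so 2^(Z+2) divides A₊ A₋. Since X and X′ are odd, A₊ + A₋ = 2 X X′ makes A₊ and A₋
-- twice two numbers of opposite parity, hence 2^(Z+1) divides one of them, say A = a 2^(Z+1).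
-- The composition then reads D₁ a² 4^(Z+1) + D₂ B² = 4 · 4^(Z+1), which forces D₁ a² ∈ {0, 3}
-- and makes D₂ a divisor of a power of 2: impossible for odd D₂ > 1.

open import Defs

module OddAndPowersOfTwo where

  open import Data.Nat
  open import Data.Nat.Properties
  open import Data.Nat.Divisibility
  open import Data.Nat.Coprimality using (Coprime; coprime-divisor)
  open import Data.Nat.Primality using (irreducible[2]; euclidsLemma; prime[2])
  open import Algebra.Properties.CommutativeSemigroup *-commutativeSemigroup using (interchange)
  open import Data.Product using (_,_)
  open import Data.Sum using (_⊎_; inj₁; inj₂; [_,_]′)
  open import Relation.Binary.PropositionalEquality
  open import Data.Empty using (⊥)
  open import Relation.Nullary using (¬_; contradiction)

  odd⇒coprime-2 : ∀ {d} → Odd d → Coprime d 2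
  odd⇒coprime-2 odd (i∣d , i∣2) with irreducible[2] i∣2
  ... | inj₁ i≡1 = i≡1
  ... | inj₂ refl = contradiction i∣d odd

  odd⇒coprime-2^ : ∀ {d} k → Odd d → Coprime d (2 ^ k)
  odd⇒coprime-2^ zero    _   (_ , i∣1)       = ∣1⇒≡1 i∣1
  odd⇒coprime-2^ (suc k) odd (i∣d , i∣2*2^k) =
    odd⇒coprime-2^ k odd (i∣d , coprime-divisor (odd⇒coprime-2 odd-i) i∣2*2^k)
    where
    odd-i : Odd _
    odd-i 2∣i = odd (∣-trans 2∣i i∣d)

  odd∤2^ : ∀ {d} k → Odd d → 1 < d → ¬ d ∣ 2 ^ k
  odd∤2^ k odd 1<d d∣2^k = <-irrefl (sym (odd⇒coprime-2^ k odd (∣-refl , d∣2^k))) 1<d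

  odd-* : ∀ {m n} → Odd m → Odd n → Odd (m * n)
  odd-* {m} {n} odd-m odd-n 2∣mn = [ odd-m , odd-n ]′ (euclidsLemma m n prime[2] 2∣mn)

  odd*square≤4⇒≡0⊎≡3 : ∀ {d} a → Odd d → 1 < d → d * (a * a) ≤ 4 →
    d * (a * a) ≡ 0 ⊎ d * (a * a) ≡ 3
  odd*square≤4⇒≡0⊎≡3 {d} zero _ _ _ = inj₁ (*-zeroʳ d)
  odd*square≤4⇒≡0⊎≡3 {3} 1 _ _ _ = inj₂ refl
  odd*square≤4⇒≡0⊎≡3 {2} 1 odd _ _ = contradiction (divides 1 refl) odd
  odd*square≤4⇒≡0⊎≡3 {4} 1 odd _ _ = contradiction (divides 2 refl) odd
  odd*square≤4⇒≡0⊎≡3 {1} 1 _ (s≤s ()) _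
  odd*square≤4⇒≡0⊎≡3 {suc (suc (suc (suc (suc _))))} 1 _ _ (s≤s (s≤s (s≤s (s≤s ()))))
  odd*square≤4⇒≡0⊎≡3 {d} a@(suc (suc _)) _ 1<d da²≤4 =
    contradiction (≤-trans (*-mono-≤ 1<d (*-mono-≤ 2≤a 2≤a)) da²≤4) 8≰4
    where
    2≤a : 2 ≤ a
    2≤a = s≤s (s≤s z≤n)
    8≰4 : ¬ 8 ≤ 4
    8≰4 (s≤s (s≤s (s≤s (s≤s ()))))

  no-representation : ∀ {d₁ d₂} k a b → Odd d₁ → 1 < d₁ → Odd d₂ → 1 < d₂ →
    d₁ * (a * a) * 2 ^ k + d₂ * (b * b) ≢ 4 * 2 ^ k
  no-representation {d₁} {d₂} k a b odd₁ 1<d₁ odd₂ 1<d₂ eq =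
    [ weight≡0 , weight≡3 ]′ (odd*square≤4⇒≡0⊎≡3 a odd₁ 1<d₁ weight≤4)
    where
    weight≤4 : d₁ * (a * a) ≤ 4
    weight≤4 = *-cancelʳ-≤ _ _ (2 ^ k) {{m^n≢0 2 k}} (≤-trans (m≤m+n _ _) (≤-reflexive eq))
    d₂b² : ℕ
    d₂b² = d₂ * (b * b)
    d₂∣ : ∀ {n} → d₂b² ≡ n → d₂ ∣ n
    d₂∣ refl = m∣m*n (b * b)
    weight≡0 : d₁ * (a * a) ≡ 0 → ⊥
    weight≡0 c≡0 = odd∤2^ (2 + k) odd₂ 1<d₂ (d₂∣ (begin
      d₂b²                    ≡⟨⟩
      0 * 2 ^ k + d₂b²        ≡⟨ cong (λ c → c * 2 ^ k + d₂b²) c≡0 ⟨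
      d₁ * (a * a) * 2 ^ k + d₂b² ≡⟨ eq ⟩
      4 * 2 ^ k               ≡⟨ *-assoc 2 2 (2 ^ k) ⟩
      2 ^ (2 + k)             ∎))
      where open ≡-Reasoning
    weight≡3 : d₁ * (a * a) ≡ 3 → ⊥
    weight≡3 c≡3 = odd∤2^ k odd₂ 1<d₂ (d₂∣ (+-cancelˡ-≡ (3 * 2 ^ k) d₂b² (2 ^ k) (begin
      3 * 2 ^ k + d₂b²            ≡⟨ cong (λ c → c * 2 ^ k + d₂b²) c≡3 ⟨
      d₁ * (a * a) * 2 ^ k + d₂b² ≡⟨ eq ⟩
      2 ^ k + 3 * 2 ^ k           ≡⟨ +-comm (2 ^ k) (3 * 2 ^ k) ⟩
      3 * 2 ^ k + 2 ^ k           ∎)))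
      where open ≡-Reasoning

  no-square-representation : ∀ {d₁ d₂} k a b → Odd d₁ → 1 < d₁ → Odd d₂ → 1 < d₂ →
    d₁ * ((a * 2 ^ k) * (a * 2 ^ k)) + d₂ * (b * b) ≢ (2 * 2 ^ k) * (2 * 2 ^ k)
  no-square-representation {d₁} {d₂} k a b odd₁ 1<d₁ odd₂ 1<d₂ eq =
    no-representation (k + k) a b odd₁ 1<d₁ odd₂ 1<d₂ (begin
      d₁ * (a * a) * 2 ^ (k + k) + d₂b²   ≡⟨ cong (λ s → d₁ * (a * a) * s + d₂b²) 2^[k+k] ⟩
      d₁ * (a * a) * (t * t) + d₂b²       ≡⟨ cong (_+ d₂b²) (*-assoc d₁ (a * a) (t * t)) ⟩
      d₁ * ((a * a) * (t * t)) + d₂b²     ≡⟨ cong (λ s → d₁ * s + d₂b²) (interchange a t a t) ⟨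
      d₁ * ((a * t) * (a * t)) + d₂b²     ≡⟨ eq ⟩
      (2 * t) * (2 * t)                   ≡⟨ interchange 2 t 2 t ⟩
      4 * (t * t)                         ≡⟨ cong (4 *_) 2^[k+k] ⟨
      4 * 2 ^ (k + k)                     ∎)
    where
    open ≡-Reasoning
    t = 2 ^ k
    d₂b² = d₂ * (b * b)
    2^[k+k] : 2 ^ (k + k) ≡ t * t
    2^[k+k] = ^-distribˡ-+-* 2 k k

module Composition where

  open OddAndPowersOfTwo
  -- ∣_∣ is renamed since, next to _∣_, it makes formulas such as  + 2 ∣ i ⊎ + 2 ∣ j  ambiguous.
  open import Data.Integer renaming (∣_∣ to abs)
  open import Data.Integer.Properties
  open import Data.Integer.Divisibility.Signed
  open import Data.Integer.Coprimality using (coprime-divisor)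
  open import Data.Integer.GCD using (gcd-greatest)
  open import Data.Integer.Tactic.RingSolver using (solve-∀)
  import Data.Nat as ℕ
  import Data.Nat.GCD as ℕ
  import Data.Nat.Properties as ℕ
  import Data.Nat.Divisibility as ℕ
  import Data.Nat.Coprimality as ℕ
  open import Data.Nat.Primality using (euclidsLemma; prime[2])
  open import Data.Product using (_×_; _,_)
  open import Data.Sum using (_⊎_; inj₁; inj₂; [_,_]′; reduce)
  import Data.Sum as Sum
  open import Relation.Binary.PropositionalEquality
  open import Relation.Nullary using (¬_; contradiction; yes; no)
  open import Function using (_∘_)

  2∣i*j⇒2∣i⊎2∣j : ∀ i j → + 2 ∣ i * j → + 2 ∣ i ⊎ + 2 ∣ j
  2∣i*j⇒2∣i⊎2∣j i j 2∣ij = Sum.map ∣ᵤ⇒∣ ∣ᵤ⇒∣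
    (euclidsLemma (abs i) (abs j) prime[2] (subst (2 ℕ.∣_) (abs-* i j) (∣⇒∣ᵤ 2∣ij)))

  2∣i*j⇒2∣i+j⇒2∣i×2∣j : ∀ {i j} → + 2 ∣ i * j → + 2 ∣ i + j → + 2 ∣ i × + 2 ∣ j
  2∣i*j⇒2∣i+j⇒2∣i×2∣j {i} {j} 2∣ij 2∣i+j with 2∣i*j⇒2∣i⊎2∣j i j 2∣ij
  ... | inj₁ 2∣i = 2∣i , ∣m+n∣m⇒∣n 2∣i+j 2∣i
  ... | inj₂ 2∣j = ∣m+n∣n⇒∣m 2∣i+j 2∣j , 2∣j

  2^∣i*j⇒2^∣j : ∀ k {i j} → Odd (abs i) → + (2 ℕ.^ k) ∣ i * j → + (2 ℕ.^ k) ∣ j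
  2^∣i*j⇒2^∣j k {i} {j} odd 2^k∣ij =
    ∣ᵤ⇒∣ (coprime-divisor (+ (2 ℕ.^ k)) i j (ℕ.sym (odd⇒coprime-2^ k odd))
      (∣⇒∣ᵤ 2^k∣ij))

  2^∣i*j⇒2^∣i⊎2^∣j : ∀ k {i j} → Odd (abs (i + j)) → + (2 ℕ.^ k) ∣ i * j →
    + (2 ℕ.^ k) ∣ i ⊎ + (2 ℕ.^ k) ∣ j
  2^∣i*j⇒2^∣i⊎2^∣j k {i} {j} odd-sum 2^k∣ij with 2 ℕ.∣? (abs i)
  ... | no odd-i = inj₂ (2^∣i*j⇒2^∣j k {i} odd-i 2^k∣ij)
  ... | yes 2∣i = inj₁ (2^∣i*j⇒2^∣j k {j} odd-j (subst (_ ∣_) (*-comm i j) 2^k∣ij))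
    where
    odd-j : Odd (abs j)
    odd-j 2∣j =
      odd-sum (∣⇒∣ᵤ (∣m∣n⇒∣m+n (∣ᵤ⇒∣ {+ 2} {i} 2∣i) (∣ᵤ⇒∣ {+ 2} {j} 2∣j)))

  2^[2+k]∣p*q⇒2^[1+k]∣p⊎2^[1+k]∣q : ∀ k {p q r} → Odd (abs r) → p + q ≡ r * + 2 →
    + (2 ℕ.^ (2 ℕ.+ k)) ∣ p * q → + (2 ℕ.^ (1 ℕ.+ k)) ∣ p ⊎ + (2 ℕ.^ (1 ℕ.+ k)) ∣ q
  2^[2+k]∣p*q⇒2^[1+k]∣p⊎2^[1+k]∣q k {p} {q} {r} odd-r p+q≡r*2 2^[2+k]∣pq
    with 2∣i*j⇒2∣i+j⇒2∣i×2∣j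
           (∣-trans (∣ᵤ⇒∣ (ℕ.m∣m*n (2 ℕ.^ (1 ℕ.+ k)))) 2^[2+k]∣pq) (divides r p+q≡r*2)
  ... | divides u p≡u*2 , divides w q≡w*2 =
    Sum.map (double p≡u*2) (double q≡w*2) (2^∣i*j⇒2^∣i⊎2^∣j k {u} {w} odd-u+w 2^k∣uw)
    where
    open ≡-Reasoning
    odd-u+w : Odd (abs (u + w))
    odd-u+w = subst (λ s → Odd (abs s)) (sym (*-cancelʳ-≡ (u + w) r (+ 2) (begin
      (u + w) * + 2       ≡⟨ *-distribʳ-+ (+ 2) u w ⟩
      u * + 2 + w * + 2   ≡⟨ cong₂ _+_ p≡u*2 q≡w*2 ⟨
      p + q               ≡⟨ p+q≡r*2 ⟩
      r * + 2             ∎))) odd-r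
    2^k∣uw : + (2 ℕ.^ k) ∣ u * w
    2^k∣uw = *-cancelˡ-∣ (+ 2) (*-cancelˡ-∣ (+ 2)
      (subst₂ _∣_ 2^[2+k]≡2*[2*2^k] pq≡2*[2*uw] 2^[2+k]∣pq))
      where
      2^[2+k]≡2*[2*2^k] : + (2 ℕ.^ (2 ℕ.+ k)) ≡ + 2 * (+ 2 * + (2 ℕ.^ k))
      2^[2+k]≡2*[2*2^k] = trans (pos-* 2 (2 ℕ.^ (1 ℕ.+ k))) (cong (+ 2 *_) (pos-* 2 (2 ℕ.^ k)))
      pq≡2*[2*uw] : p * q ≡ + 2 * (+ 2 * (u * w))
      pq≡2*[2*uw] = trans (cong₂ _*_ p≡u*2 q≡w*2) (regroup u w)
        where
        regroup : ∀ u w → (u * + 2) * (w * + 2) ≡ + 2 * (+ 2 * (u * w))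
        regroup = solve-∀
    double : ∀ {i s} → i ≡ s * + 2 → + (2 ℕ.^ k) ∣ s → + (2 ℕ.^ (1 ℕ.+ k)) ∣ i
    double {i} {s} i≡s*2 2^k∣s =
      subst₂ _∣_ (sym (pos-* 2 (2 ℕ.^ k))) (trans (*-comm (+ 2) s) (sym i≡s*2))
        (*-monoʳ-∣ (+ 2) 2^k∣s)

  ^2≡* : ∀ i → i ^ 2 ≡ i * i
  ^2≡* i = cong (i *_) (*-identityʳ i)

  i*i≡+∣i∣*∣i∣ : ∀ i → i * i ≡ + (abs i ℕ.* abs i)
  i*i≡+∣i∣*∣i∣ +0       = refl
  i*i≡+∣i∣*∣i∣ +[1+ _ ] = refl
  i*i≡+∣i∣*∣i∣ -[1+ _ ] = refl

  -i^2≡i^2 : ∀ i → (- i) ^ 2 ≡ i ^ 2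
  -i^2≡i^2 i = trans (^2≡* (- i)) (trans (-i*-i≡i*i i) (sym (^2≡* i)))
    where
    -i*-i≡i*i : ∀ i → (- i) * (- i) ≡ i * i
    -i*-i≡i*i = solve-∀

  weighted-squares-abs : ∀ m n x y {k} → + m * (x * x) + + n * (y * y) ≡ + k →
    m ℕ.* (abs x ℕ.* abs x) ℕ.+ n ℕ.* (abs y ℕ.* abs y) ≡ k
  weighted-squares-abs m n x y {k} eq = +-injective (begin
    + (m ℕ.* (abs x ℕ.* abs x)) + + (n ℕ.* (abs y ℕ.* abs y))
      ≡⟨ cong₂ _+_ (pos-* m _) (pos-* n _) ⟩
    + m * + (abs x ℕ.* abs x) + + n * + (abs y ℕ.* abs y)
      ≡⟨ cong₂ (λ s t → + m * s + + n * t) (i*i≡+∣i∣*∣i∣ x) (i*i≡+∣i∣*∣i∣ y) ⟨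
    + m * (x * x) + + n * (y * y)
      ≡⟨ eq ⟩
    + k ∎)
    where open ≡-Reasoning

  composition : ∀ a b x y u v →
    a * ((x * u + b * y * v) * (x * u + b * y * v)) + b * ((a * x * v - y * u) * (a * x * v - y * u))
    ≡ (a * (x * x) + b * (y * y)) * (+ 1 * (u * u) + a * b * (v * v))
  composition = solve-∀

  conjugates-sum : ∀ b x y u v → (x * u + b * y * v) + (x * u + b * y * - v) ≡ x * u * + 2
  conjugates-sum = solve-∀

  conjugates-product : ∀ {n} a b x y u v →
    a * (x * x) + b * (y * y) ≡ n → + 1 * (u * u) + a * b * (v * v) ≡ n →
    n ∣ a * ((x * u + b * y * v) * (x * u + b * y * - v))
  conjugates-product {n} a b x y u v P≡n Q≡n = divides (n - c - d) (begin
    a * ((x * u + b * y * v) * (x * u + b * y * - v))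
      ≡⟨ expand a b x y u v ⟩
    P * Q - P * c - Q * d
      ≡⟨ cong₂ (λ P Q → P * Q - P * c - Q * d) P≡n Q≡n ⟩
    n * n - n * c - n * d
      ≡⟨ factor n c d ⟩
    (n - c - d) * n ∎)
    where
    open ≡-Reasoning
    P = a * (x * x) + b * (y * y)
    Q = + 1 * (u * u) + a * b * (v * v)
    c = a * b * (v * v)
    d = b * (y * y)
    expand : ∀ a b x y u v → a * ((x * u + b * y * v) * (x * u + b * y * - v))
      ≡ (a * (x * x) + b * (y * y)) * (+ 1 * (u * u) + a * b * (v * v))
        - (a * (x * x) + b * (y * y)) * (a * b * (v * v))
        - (+ 1 * (u * u) + a * b * (v * v)) * (b * (y * y))
    expand = solve-∀
    factor : ∀ n c d → n * n - n * c - n * d ≡ (n - c - d) * n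
    factor = solve-∀

  solution-equation : ∀ A B X Y {Z} → IsSolution A B X Y Z →
    + A * (X * X) + + B * (Y * Y) ≡ + (2 ℕ.^ (2 ℕ.+ Z))
  solution-equation A B X Y {Z} (eq , _) = begin
    + A * (X * X) + + B * (Y * Y) ≡⟨ cong₂ (λ s t → + A * s + + B * t) (^2≡* X) (^2≡* Y) ⟨
    + A * X ^ 2 + + B * Y ^ 2     ≡⟨ eq ⟩
    + (2 ℕ.^ (Z ℕ.+ 2))          ≡⟨ cong (λ n → + (2 ℕ.^ n)) (ℕ.+-comm Z 2) ⟩
    + (2 ℕ.^ (2 ℕ.+ Z))          ∎
    where open ≡-Reasoning

  product-solution-equation : ∀ D₁ D₂ X Y {Z} → IsSolution 1 (D₁ ℕ.* D₂) X Y Z →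
    + 1 * (X * X) + + D₁ * + D₂ * (Y * Y) ≡ + (2 ℕ.^ (2 ℕ.+ Z))
  product-solution-equation D₁ D₂ X Y sol =
    trans (cong (λ c → + 1 * (X * X) + c * (Y * Y)) (sym (pos-* D₁ D₂)))
      (solution-equation 1 (D₁ ℕ.* D₂) X Y sol)

  solution-odd : ∀ A B X Y {Z} → Odd B → IsSolution A B X Y Z → Odd (abs X)
  solution-odd A B X Y {Z} odd-B sol@(_ , gcd≡1 , _) 2∣X =
    2∤1 (subst (2 ℕ.∣_) (+-injective gcd≡1) (gcd-greatest {X} {Y} {+ 2} 2∣X 2∣Y))
    where
    2∣N : + 2 ∣ + A * (X * X) + + B * (Y * Y)
    2∣N = subst (+ 2 ∣_) (sym (solution-equation A B X Y sol))
      (∣ᵤ⇒∣ (ℕ.m∣m*n (2 ℕ.^ (1 ℕ.+ Z))))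
    2∣BY² : + 2 ∣ + B * (Y * Y)
    2∣BY² = ∣m+n∣m⇒∣n 2∣N (∣n⇒∣m*n (+ A) (∣m⇒∣m*n X (∣ᵤ⇒∣ {+ 2} {X} 2∣X)))
    2∣Y : 2 ℕ.∣ abs Y
    2∣Y = ∣⇒∣ᵤ ([ (λ 2∣B → contradiction (∣⇒∣ᵤ 2∣B) odd-B) , reduce ∘ 2∣i*j⇒2∣i⊎2∣j Y Y ]′
                   (2∣i*j⇒2∣i⊎2∣j (+ B) (Y * Y) 2∣BY²))
    2∤1 : ¬ 2 ℕ.∣ 1
    2∤1 2∣1 = contradiction (ℕ.∣1⇒≡1 2∣1) λ ()

  solution-neg : ∀ A B X Y {Z} → IsSolution A B X Y Z → IsSolution A B X (- Y) Z
  solution-neg A B X Y (eq , gcd≡1 , 0<Z) =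
    trans (cong (λ s → + A * X ^ 2 + + B * s) (-i^2≡i^2 Y)) eq ,
    trans (cong (λ n → + ℕ.gcd (abs X) n) (∣-i∣≡∣i∣ Y)) gcd≡1 ,
    0<Z

  composite-not-divisible : ∀ {D₁ D₂} X Y X′ V {Z} → Odd D₁ → 1 ℕ.< D₁ → Odd D₂ → 1 ℕ.< D₂ →
    IsSolution D₁ D₂ X Y Z → IsSolution 1 (D₁ ℕ.* D₂) X′ V Z →
    ¬ + (2 ℕ.^ (1 ℕ.+ Z)) ∣ X * X′ + + D₂ * Y * V
  composite-not-divisible {D₁} {D₂} X Y X′ V {Z} odd₁ 1<D₁ odd₂ 1<D₂ sol sol′ (divides a A≡a*t) =
    no-square-representation (1 ℕ.+ Z) (abs a) (abs B) odd₁ 1<D₁ odd₂ 1<D₂ (begin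
      D₁ ℕ.* ((abs a ℕ.* t) ℕ.* (abs a ℕ.* t)) ℕ.+ D₂ ℕ.* (abs B ℕ.* abs B)
        ≡⟨ cong (λ s → D₁ ℕ.* (s ℕ.* s) ℕ.+ D₂ ℕ.* (abs B ℕ.* abs B)) ∣A∣≡∣a∣*t ⟨
      D₁ ℕ.* (abs A ℕ.* abs A) ℕ.+ D₂ ℕ.* (abs B ℕ.* abs B)
        ≡⟨ weighted-squares-abs D₁ D₂ A B composed ⟩
      N ℕ.* N ∎)
    where
    open ≡-Reasoning
    t = 2 ℕ.^ (1 ℕ.+ Z)
    N = 2 ℕ.^ (2 ℕ.+ Z)
    A = X * X′ + + D₂ * Y * V
    B = + D₁ * X * V - Y * X′
    ∣A∣≡∣a∣*t : abs A ≡ abs a ℕ.* t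
    ∣A∣≡∣a∣*t = trans (cong abs A≡a*t) (abs-* a (+ t))
    composed : + D₁ * (A * A) + + D₂ * (B * B) ≡ + (N ℕ.* N)
    composed = begin
      + D₁ * (A * A) + + D₂ * (B * B)
        ≡⟨ composition (+ D₁) (+ D₂) X Y X′ V ⟩
      (+ D₁ * (X * X) + + D₂ * (Y * Y)) * (+ 1 * (X′ * X′) + + D₁ * + D₂ * (V * V))
        ≡⟨ cong₂ _*_ (solution-equation D₁ D₂ X Y sol)
                     (product-solution-equation D₁ D₂ X′ V sol′) ⟩
      + N * + N
        ≡⟨ pos-* N N ⟨
      + (N ℕ.* N) ∎

  conjugate-divisible : ∀ {D₁ D₂} X Y X′ Y′ {Z} → Odd D₁ → Odd D₂ →
    IsSolution D₁ D₂ X Y Z → IsSolution 1 (D₁ ℕ.* D₂) X′ Y′ Z →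
    + (2 ℕ.^ (1 ℕ.+ Z)) ∣ X * X′ + + D₂ * Y * Y′ ⊎ + (2 ℕ.^ (1 ℕ.+ Z)) ∣ X * X′ + + D₂ * Y * - Y′
  conjugate-divisible {D₁} {D₂} X Y X′ Y′ {Z} odd₁ odd₂ sol sol′ =
    2^[2+k]∣p*q⇒2^[1+k]∣p⊎2^[1+k]∣q Z {r = X * X′} odd-XX′ (conjugates-sum (+ D₂) X Y X′ Y′)
      (2^∣i*j⇒2^∣j (2 ℕ.+ Z) {+ D₁} odd₁
        (conjugates-product (+ D₁) (+ D₂) X Y X′ Y′
          (solution-equation D₁ D₂ X Y sol) (product-solution-equation D₁ D₂ X′ Y′ sol′)))
    where
    odd-XX′ : Odd (abs (X * X′))
    odd-XX′ = subst Odd (sym (abs-* X X′))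
      (odd-* (solution-odd D₁ D₂ X Y odd₂ sol)
             (solution-odd 1 (D₁ ℕ.* D₂) X′ Y′ (odd-* odd₁ odd₂) sol′))

open import Data.Nat using (ℕ; _<_; _*_)
open import Data.Nat.Coprimality using (Coprime)
open import Data.Integer using (ℤ; -_)
open import Data.Product using (∃-syntax; _,_)
open import Data.Sum using ([_,_]′)
open import Relation.Nullary using (¬_)
open Composition using (composite-not-divisible; conjugate-divisible; solution-neg)

lemma2p16 : (D₁ D₂ : ℕ) → Odd D₁ → Odd D₂ → Coprime D₁ D₂ → 1 < D₁ → 1 < D₂ →
    (X Y : ℤ) (Z : ℕ) → IsSolution D₁ D₂ X Y Z →
    ¬ (∃[ X′ ] ∃[ Y′ ] IsSolution 1 (D₁ * D₂) X′ Y′ Z)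
lemma2p16 D₁ D₂ odd₁ odd₂ _ 1<D₁ 1<D₂ X Y Z sol (X′ , Y′ , sol′) =
  [ composite-not-divisible X Y X′ Y′ odd₁ 1<D₁ odd₂ 1<D₂ sol sol′
  , composite-not-divisible X Y X′ (- Y′) odd₁ 1<D₁ odd₂ 1<D₂ sol
      (solution-neg 1 (D₁ * D₂) X′ Y′ sol′)
  ]′ (conjugate-divisible X Y X′ Y′ odd₁ odd₂ sol sol′)
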